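{- Let $\mathbf{n}=(n_1,\dots,n_k)\in\mathbb{Z}_{>0}^k$ and assume $n_1\ge n_2\ge\dots\ge n_k$. If $\frac{n_j}{n_{j+1}}\ge\frac{2k}{k-1}$ for all $2\le j\le k-2$, and $\gcd(n_{k-1},n_k)\le\frac{k-1}{k+1}(n_{k-1}-n_k)$, then $\mathbf{n}$ is a lonely runner instance.
   Context: A vector $\mathbf{n}\in\mathbb{Z}_{>0}^k$ is a lonely runner instance if there exists a real number $t$ such that for all $1\le j\le k$ the distance of $tn_j$ to the nearest integer is at least $\frac{1}{k+1}$. -}

module Defs where

open import Data.Nat using (ℕ; zero; suc)
open import Data.Vec using (Vec; []; _∷_; lookup)
open import Data.Fin using (Fin)
open import Data.Product using (Σ)
open import Data.Integer using (ℤ; +_)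
open import Data.Rational using (ℚ; _/_; _*_; _-_; ∣_∣; _≤_)

-- 1-indexed access: nth v j = n_j for 1 ≤ j ≤ k; 0 outside that range
-- (only ever used with in-range indices in the statement).
nth : ∀ {k} → Vec ℕ k → ℕ → ℕ
nth []       _             = 0
nth (x ∷ xs) zero          = 0
nth (x ∷ xs) (suc zero)    = x
nth (x ∷ xs) (suc (suc j)) = nth xs (suc j)

FarFromIntegers : ℕ → ℚ → Set
FarFromIntegers k x = ∀ (m : ℤ) → (+ 1 / suc k) ≤ ∣ x - (m / 1) ∣

LonelyRunnerInstance : ∀ {k} → Vec ℕ k → Set
LonelyRunnerInstance {k} n =
  Σ ℚ λ t → ∀ (j : Fin k) → FarFromIntegers k (t * ((+ lookup n j) / 1))

module Submission where

-- Put N = k + 1.  For a speed a and an integer c, the window c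
-- of a is the interval of times t with a·t ∈ [c + 1/N, c + k/N]; at such a
-- time runner a is at distance ≥ 1/N from every integer.  The speeds are
-- processed from the slowest one upwards, shrinking a window at each step:
--   * the last pair (n_{k−1}, n_k): since the offsets b·c − a·e realise every
--     multiple of gcd(n_{k−1}, n_k) (Bézout), the gcd hypothesis yields a window
--     of n_{k−1} inside a window of n_k;
--   * for 2 ≤ j ≤ k − 2 the ratio n_j / n_{j+1} ≥ 2k/(k−1) makes the windows of
--     n_j so dense that every window of n_{j+1} contains a whole one of n_j;
--   * n_1 need not be nested: as 2·n_2 ≤ (k−1)·n_1, each window of n_2 at least
--     meets a window of n_1, at one of the two left ends.
-- A time in the final intersection is good for every runner.
--
-- Times are fractions T/D and everything is stated as natural-number
-- inequalities after cross-multiplying.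

open import Defs
open import Data.Nat using (ℕ; _+_; _*_; _∸_; _≤_; _<_)
open import Data.Nat.GCD using (gcd)
open import Data.Vec using (Vec)

open import Data.Nat using (zero; suc; s≤s; s≤s⁻¹; z≤n; _≤?_; ∣_-_∣; >-nonZero)
open import Data.Nat.Properties
open import Data.Nat.GCD using (gcd-GCD; gcd[m,n]≢0; module Bézout)
open import Data.Nat.Tactic.RingSolver using (solve)
open import Data.Integer as ℤ using (ℤ; +_; -[1+_]; _⊖_)
import Data.Integer.Properties as ℤP
import Data.Integer.Tactic.RingSolver as ℤ-Solver
open import Data.Rational as ℚ using (_/_; toℚᵘ)
import Data.Rational.Properties as ℚP
open import Data.Rational.Unnormalised as U using (mkℚᵘ; *≡*; *≤*)
import Data.Rational.Unnormalised.Properties as UP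
open import Data.Fin using (Fin; toℕ)
open import Data.Fin.Properties using (toℕ<n)
open import Data.Vec as Vec using (lookup)
open import Data.List using ([]; _∷_)
open import Data.Product using (Σ; _,_; _×_; proj₂)
open import Data.Sum using (inj₁; inj₂)
open import Data.Empty using (⊥-elim)
open import Relation.Nullary using (Dec; yes; no)
open import Relation.Binary.PropositionalEquality

-- P/D lies in the window c: the cross-multiplied form of
-- c + 1/(k+1) ≤ P/D ≤ c + k/(k+1).
record InWindow (k P D c : ℕ) : Set where
  constructor in-window
  field
    lower : D * (c * suc k + 1) ≤ suc k * P
    upper : suc k * P ≤ D * (c * suc k + k)

separated : ∀ {u v D} → D + v ≤ u → D ≤ ∣ u - v ∣
separated {u} {v} {D} D+v≤u =
  subst (D ≤_) (sym (m≤n⇒∣n-m∣≡n∸m (≤-trans (m≤n+m v D) D+v≤u))) (m+n≤o⇒m≤o∸n D D+v≤u)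

∣⊖∣≡∣-∣ : ∀ m n → ℤ.∣ m ⊖ n ∣ ≡ ∣ m - n ∣
∣⊖∣≡∣-∣ m n with ≤-total m n
... | inj₁ m≤n = trans (ℤP.∣⊖∣-≤ m≤n) (sym (m≤n⇒∣m-n∣≡n∸m m≤n))
... | inj₂ n≤m = trans (cong ℤ.∣_∣ (ℤP.⊖-≥ n≤m)) (sym (m≤n⇒∣n-m∣≡n∸m n≤m))

-- For m ≤ c the window
-- lies above m + 1/(k+1), for m > c below m − 1/(k+1).
window-far : ∀ {k P D c} → InWindow k P D c → ∀ m → D ≤ ℤ.∣ + P ℤ.- m ℤ.* + D ∣ * suc k
window-far {k} {P} {D} {c} (in-window lower upper) (+ M) = subst (D ≤_) (sym scaled) (compare (M ≤? c))
  where
  scaled : ℤ.∣ + P ℤ.- + M ℤ.* + D ∣ * suc k ≡ ∣ P * suc k - M * D * suc k ∣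
  scaled = begin
    ℤ.∣ + P ℤ.- + M ℤ.* + D ∣ * suc k ≡⟨ cong (λ u → ℤ.∣ + P ℤ.- u ∣ * suc k) (ℤP.pos-* M D) ⟨
    ℤ.∣ + P ℤ.- + (M * D) ∣ * suc k   ≡⟨ cong (λ u → ℤ.∣ u ∣ * suc k) (ℤP.[+m]-[+n]≡m⊖n P (M * D)) ⟩
    ℤ.∣ P ⊖ M * D ∣ * suc k           ≡⟨ cong (_* suc k) (∣⊖∣≡∣-∣ P (M * D)) ⟩
    ∣ P - M * D ∣ * suc k             ≡⟨ *-distribʳ-∣-∣ (suc k) P (M * D) ⟩
    ∣ P * suc k - M * D * suc k ∣     ∎
    where open ≡-Reasoning
  compare : Dec (M ≤ c) → D ≤ ∣ P * suc k - M * D * suc k ∣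
  compare (yes M≤c) = separated (begin
    D + M * D * suc k     ≤⟨ +-monoʳ-≤ D (*-monoˡ-≤ (suc k) (*-monoˡ-≤ D M≤c)) ⟩
    D + c * D * suc k     ≡⟨ solve (c ∷ D ∷ k ∷ []) ⟩
    D * (c * suc k + 1)   ≤⟨ lower ⟩
    suc k * P             ≡⟨ *-comm (suc k) P ⟩
    P * suc k             ∎)
    where open ≤-Reasoning
  compare (no M≰c) = subst (D ≤_) (∣-∣-comm (M * D * suc k) (P * suc k)) (separated (begin
    D + P * suc k         ≡⟨ cong (λ u → D + u) (*-comm P (suc k)) ⟩
    D + suc k * P         ≤⟨ +-monoʳ-≤ D upper ⟩
    D + D * (c * suc k + k) ≡⟨ solve (c ∷ D ∷ k ∷ []) ⟩
    suc c * D * suc k     ≤⟨ *-monoˡ-≤ (suc k) (*-monoˡ-≤ D (≰⇒> M≰c)) ⟩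
    M * D * suc k         ∎))
    where open ≤-Reasoning
window-far {k} {P} {D} {c} (in-window lower _) -[1+ M ] = subst (D ≤_) (sym shifted) (begin
  D                          ≡⟨ *-identityʳ D ⟨
  D * 1                      ≤⟨ *-monoʳ-≤ D (m≤n+m 1 (c * suc k)) ⟩
  D * (c * suc k + 1)        ≤⟨ lower ⟩
  suc k * P                  ≡⟨ *-comm (suc k) P ⟩
  P * suc k                  ≤⟨ *-monoˡ-≤ (suc k) (m≤m+n P (suc M * D)) ⟩
  (P + suc M * D) * suc k    ∎)
  where
  open ≤-Reasoning
  shifted : ℤ.∣ + P ℤ.- -[1+ M ] ℤ.* + D ∣ * suc k ≡ (P + suc M * D) * suc k
  shifted = cong (λ u → ℤ.∣ + P ℤ.+ u ∣ * suc k)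
                 (trans (ℤP.neg-distribˡ-* -[1+ M ] (+ D)) (sym (ℤP.pos-* (suc M) D)))

-- The cross-multiplied form of  (p/d)·r − m = (p·r − m·d)/d,  with the
-- denominators d₁, d₂ in the shape produced by the rational operations.
cross-multiplied : ∀ (p r m d : ℤ) {d₁ d₂} → d₁ ≡ d → d₂ ≡ d →
  (p ℤ.* r ℤ.* + 1 ℤ.+ ℤ.- m ℤ.* d₁) ℤ.* d ≡ (p ℤ.* r ℤ.- m ℤ.* d) ℤ.* d₂
cross-multiplied p r m d refl refl = identity p r m d
  where
  identity : ∀ p r m d → (p ℤ.* r ℤ.* + 1 ℤ.+ ℤ.- m ℤ.* d) ℤ.* d ≡ (p ℤ.* r ℤ.- m ℤ.* d) ℤ.* d
  identity = ℤ-Solver.solve-∀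

distance≃ : ∀ (p r m : ℤ) D' →
  toℚᵘ ℚ.∣ (p / suc D') ℚ.* (r / 1) ℚ.- m / 1 ∣ U.≃ mkℚᵘ (+ ℤ.∣ p ℤ.* r ℤ.- m ℤ.* + suc D' ∣) D'
distance≃ p r m D' = begin
  toℚᵘ ℚ.∣ x ℚ.* y ℚ.- z ∣                   ≈⟨ ℚP.toℚᵘ-homo-∣-∣ (x ℚ.* y ℚ.- z) ⟩
  U.∣ toℚᵘ (x ℚ.* y ℚ.- z) ∣                 ≈⟨ UP.∣-∣-cong (ℚP.toℚᵘ-homo-+ (x ℚ.* y) (ℚ.- z)) ⟩
  U.∣ toℚᵘ (x ℚ.* y) U.+ toℚᵘ (ℚ.- z) ∣      ≈⟨ UP.∣-∣-cong (UP.+-cong (ℚP.toℚᵘ-homo-* x y) (ℚP.toℚᵘ-homo‿- z)) ⟩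
  U.∣ toℚᵘ x U.* toℚᵘ y U.- toℚᵘ z ∣         ≈⟨ UP.∣-∣-cong (UP.+-cong (UP.*-cong (ℚP.toℚᵘ-fromℚᵘ (mkℚᵘ p D'))
                                                 (ℚP.toℚᵘ-fromℚᵘ (mkℚᵘ r 0))) (UP.-‿cong (ℚP.toℚᵘ-fromℚᵘ (mkℚᵘ m 0)))) ⟩
  U.∣ mkℚᵘ p D' U.* mkℚᵘ r 0 U.- mkℚᵘ m 0 ∣  ≈⟨ UP.∣-∣-cong difference ⟩
  U.∣ mkℚᵘ (p ℤ.* r ℤ.- m ℤ.* + suc D') D' ∣ ∎
  where
  open UP.≃-Reasoning
  x = p / suc D'
  y = r / 1
  z = m / 1
  difference : mkℚᵘ p D' U.* mkℚᵘ r 0 U.- mkℚᵘ m 0 U.≃ mkℚᵘ (p ℤ.* r ℤ.- m ℤ.* + suc D') D'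
  difference = *≡* (cross-multiplied p r m (+ suc D') (cong +_ (*-identityʳ (suc D')))
                                     (cong +_ (trans (*-identityʳ _) (*-identityʳ _))))

far-from-integers : ∀ k (p r : ℤ) D' → (∀ m → suc D' ≤ ℤ.∣ p ℤ.* r ℤ.- m ℤ.* + suc D' ∣ * suc k) →
                    FarFromIntegers k ((p / suc D') ℚ.* (r / 1))
far-from-integers k p r D' far m = ℚP.toℚᵘ-cancel-≤ (begin
  toℚᵘ (+ 1 / suc k)                            ≃⟨ ℚP.toℚᵘ-fromℚᵘ (mkℚᵘ (+ 1) k) ⟩
  mkℚᵘ (+ 1) k                                  ≤⟨ *≤* cross-multiplied-bound ⟩
  mkℚᵘ (+ distance) D'                          ≃⟨ distance≃ p r m D' ⟨
  toℚᵘ ℚ.∣ (p / suc D') ℚ.* (r / 1) ℚ.- m / 1 ∣ ∎)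
  where
  open UP.≤-Reasoning
  distance = ℤ.∣ p ℤ.* r ℤ.- m ℤ.* + suc D' ∣
  cross-multiplied-bound : + 1 ℤ.* + suc D' ℤ.≤ + distance ℤ.* + suc k
  cross-multiplied-bound = subst₂ ℤ._≤_ (sym (ℤP.*-identityˡ (+ suc D'))) (ℤP.pos-* distance (suc k))
                                  (ℤ.+≤+ (far m))

-- The window c of speed a (times t with a·t ∈ [c + 1/(k+1), c + k/(k+1)])
-- is contained in the window c' of speed b.
record WindowSub (k a c b c' : ℕ) : Set where
  constructor nested
  field
    left  : a * (c' * suc k + 1) ≤ b * (c * suc k + 1)
    right : b * (c * suc k + k) ≤ a * (c' * suc k + k)

window-sub : ∀ {k a c b c' D} T → 0 < a → WindowSub k a c b c' → InWindow k (T * a) D c → InWindow k (T * b) D c'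
window-sub {k} {a} {c} {b} {c'} {D} T 0<a (nested left right) (in-window lower upper) = in-window lower′ upper′
  where
  instance _ = >-nonZero 0<a
  open ≤-Reasoning
  lower′ : D * (c' * suc k + 1) ≤ suc k * (T * b)
  lower′ = *-cancelˡ-≤ a (begin
    a * (D * (c' * suc k + 1)) ≡⟨ solve (a ∷ D ∷ c' ∷ k ∷ []) ⟩
    D * (a * (c' * suc k + 1)) ≤⟨ *-monoʳ-≤ D left ⟩
    D * (b * (c * suc k + 1))  ≡⟨ solve (b ∷ D ∷ c ∷ k ∷ []) ⟩
    b * (D * (c * suc k + 1))  ≤⟨ *-monoʳ-≤ b lower ⟩
    b * (suc k * (T * a))      ≡⟨ solve (a ∷ b ∷ k ∷ T ∷ []) ⟩
    a * (suc k * (T * b))      ∎)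
  upper′ : suc k * (T * b) ≤ D * (c' * suc k + k)
  upper′ = *-cancelˡ-≤ a (begin
    a * (suc k * (T * b))      ≡⟨ solve (a ∷ b ∷ k ∷ T ∷ []) ⟩
    b * (suc k * (T * a))      ≤⟨ *-monoʳ-≤ b upper ⟩
    b * (D * (c * suc k + k))  ≡⟨ solve (b ∷ D ∷ c ∷ k ∷ []) ⟩
    D * (b * (c * suc k + k))  ≤⟨ *-monoʳ-≤ D right ⟩
    D * (a * (c' * suc k + k)) ≡⟨ solve (a ∷ D ∷ c' ∷ k ∷ []) ⟩
    a * (D * (c' * suc k + k)) ∎)

progression-hits : ∀ P off A → 1 ≤ P → off ≤ P → Σ ℕ λ c → A ≤ c * P + off × c * P + off ≤ A + P
progression-hits P off zero 1≤P off≤P = 0 , z≤n , off≤P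
progression-hits P off (suc A) 1≤P off≤P with progression-hits P off A 1≤P off≤P
... | c , A≤x , x≤A+P with m≤n⇒m<n∨m≡n A≤x
...   | inj₁ A<x = c , A<x , ≤-trans x≤A+P (n≤1+n _)
...   | inj₂ A≡x = suc c , subst (suc A ≤_) (sym next) (+-monoˡ-≤ A 1≤P)
                         , subst (_≤ suc A + P) (sym next) (subst (_≤ suc A + P) (+-comm A P) (n≤1+n _))
  where
  next : suc c * P + off ≡ P + A
  next = trans (+-assoc P (c * P) off) (cong (λ u → P + u) (sym A≡x))

left-end-hits : ∀ k Q A → 0 < Q → Σ ℕ λ c → A ≤ Q * (c * suc k + 1) × Q * (c * suc k + 1) ≤ A + Q * suc k
left-end-hits k Q A 0<Q with progression-hits (Q * suc k) Q A (*-mono-≤ 0<Q (s≤s z≤n)) (m≤m*n Q (suc k))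
... | c , A≤x , x≤A+P = c , subst (A ≤_) (sym expand) A≤x , subst (_≤ A + Q * suc k) (sym expand) x≤A+P
  where
  expand : Q * (c * suc k + 1) ≡ c * (Q * suc k) + Q
  expand = solve (Q ∷ c ∷ k ∷ [])

window-step : ∀ {k a b} → 1 ≤ k → 0 < b → 2 * k * b ≤ (k ∸ 1) * a → ∀ c' → Σ ℕ λ c → WindowSub k a c b c'
window-step {suc k} {a} {b} _ 0<b ratio c' with left-end-hits (suc k) b (a * (c' * suc (suc k) + 1)) 0<b
... | c , left , near = c , nested left (begin
  b * (c * suc (suc k) + suc k)                  ≡⟨ solve (b ∷ c ∷ k ∷ []) ⟩
  b * (c * suc (suc k) + 1) + k * b              ≤⟨ +-monoˡ-≤ (k * b) near ⟩
  a * (c' * suc (suc k) + 1) + b * suc (suc k) + k * b ≡⟨ solve (a ∷ b ∷ c' ∷ k ∷ []) ⟩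
  a * (c' * suc (suc k) + 1) + 2 * suc k * b     ≤⟨ +-monoʳ-≤ (a * (c' * suc (suc k) + 1)) ratio ⟩
  a * (c' * suc (suc k) + 1) + k * a             ≡⟨ solve (a ∷ c' ∷ k ∷ []) ⟩
  a * (c' * suc (suc k) + suc k)                 ∎)
  where open ≤-Reasoning

bezout-multiple : ∀ a b → 0 < a → 0 < b → ∀ s → Σ ℕ λ c → Σ ℕ λ e → b * c ≡ a * e + gcd a b * s
bezout-multiple a b 0<a 0<b s with unit (Bézout.identity (gcd-GCD a b))
  where
  unit : Bézout.Identity (gcd a b) a b → Σ ℕ λ c → Σ ℕ λ e → b * c ≡ a * e + gcd a b
  unit (Bézout.-+ x y eq) = y , x , trans (*-comm b y) (sym (trans (+-comm (a * x) _) (trans (cong (λ u → gcd a b + u) (*-comm a x)) eq)))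
  unit (Bézout.+- x y eq) = a * (x + y) ∸ y , b * (x + y) ∸ x , shifted (a * (x + y) ∸ y) (b * (x + y) ∸ x)
                                 (m∸n+n≡m (≤-trans (m≤n+m y x) (m≤n*m (x + y) a {{>-nonZero 0<a}})))
                                 (m∸n+n≡m (≤-trans (m≤m+n x y) (m≤n*m (x + y) b {{>-nonZero 0<b}})))
    where
    shifted : ∀ u v → u + y ≡ a * (x + y) → v + x ≡ b * (x + y) → b * u ≡ a * v + gcd a b
    shifted u v u+y v+x = +-cancelʳ-≡ (b * y) (b * u) (a * v + gcd a b) (begin
      b * u + b * y             ≡⟨ *-distribˡ-+ b u y ⟨
      b * (u + y)               ≡⟨ cong (b *_) u+y ⟩
      b * (a * (x + y))         ≡⟨ solve (a ∷ b ∷ x ∷ y ∷ []) ⟩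
      a * (b * (x + y))         ≡⟨ cong (a *_) v+x ⟨
      a * (v + x)               ≡⟨ solve (a ∷ v ∷ x ∷ []) ⟩
      a * v + x * a             ≡⟨ cong (λ u → a * v + u) eq ⟨
      a * v + (gcd a b + y * b) ≡⟨ cong (λ w → a * v + (gcd a b + w)) (*-comm y b) ⟩
      a * v + (gcd a b + b * y) ≡⟨ +-assoc (a * v) _ _ ⟨
      a * v + gcd a b + b * y   ∎)
      where open ≡-Reasoning
... | c , e , eq = c * s , e * s , (begin
  b * (c * s)             ≡⟨ *-assoc b c s ⟨
  b * c * s               ≡⟨ cong (_* s) eq ⟩
  (a * e + gcd a b) * s   ≡⟨ *-distribʳ-+ s (a * e) _ ⟩
  a * e * s + gcd a b * s ≡⟨ cong (_+ gcd a b * s) (*-assoc a e s) ⟩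
  a * (e * s) + gcd a b * s ∎)
  where open ≡-Reasoning

offset-window-sub : ∀ {k a b c e h} → b * c ≡ a * e + h → a ≤ h * suc k + b → h * suc k + b * k ≤ a * k →
                    WindowSub k a c b e
offset-window-sub {k} {a} {b} {c} {e} {h} offset left right = nested lower upper
  where
  open ≤-Reasoning
  lower : a * (e * suc k + 1) ≤ b * (c * suc k + 1)
  lower = begin
    a * (e * suc k + 1)             ≡⟨ solve (a ∷ e ∷ k ∷ []) ⟩
    a * e * suc k + a               ≤⟨ +-monoʳ-≤ (a * e * suc k) left ⟩
    a * e * suc k + (h * suc k + b) ≡⟨ solve (a ∷ e ∷ h ∷ k ∷ b ∷ []) ⟩
    (a * e + h) * suc k + b         ≡⟨ cong (λ u → u * suc k + b) offset ⟨
    b * c * suc k + b               ≡⟨ solve (b ∷ c ∷ k ∷ []) ⟩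
    b * (c * suc k + 1)             ∎
  upper : b * (c * suc k + k) ≤ a * (e * suc k + k)
  upper = begin
    b * (c * suc k + k)                 ≡⟨ solve (b ∷ c ∷ k ∷ []) ⟩
    b * c * suc k + b * k               ≡⟨ cong (λ u → u * suc k + b * k) offset ⟩
    (a * e + h) * suc k + b * k         ≡⟨ solve (a ∷ e ∷ h ∷ k ∷ b ∷ []) ⟩
    a * e * suc k + (h * suc k + b * k) ≤⟨ +-monoʳ-≤ (a * e * suc k) right ⟩
    a * e * suc k + a * k               ≡⟨ solve (a ∷ e ∷ k ∷ []) ⟩
    a * (e * suc k + k)                 ∎

gcd-positive : ∀ a {b} → 0 < b → 0 < gcd a b
gcd-positive a {b} 0<b = n≢0⇒n>0 (gcd[m,n]≢0 a b (inj₂ (λ b≡0 → <⇒≢ 0<b (sym b≡0))))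

-- The hypothesis on the last pair: if (k+1)·gcd(a,b) ≤ (k−1)(a−b), some window
-- of a lies inside some window of b.  The offset is taken as the multiple of
-- gcd(a,b) (times k+1) just above a − b.
window-gcd : ∀ {k a b} → 0 < b → b ≤ a → (k + 1) * gcd a b ≤ (k ∸ 1) * (a ∸ b) →
             Σ ℕ λ c → Σ ℕ λ e → WindowSub k a c b e
window-gcd {zero} {a} {b} 0<b b≤a bound =
  ⊥-elim (<⇒≱ (gcd-positive a 0<b) (subst (_≤ 0) (+-identityʳ (gcd a b)) bound))
window-gcd {suc k} {a} {b} 0<b b≤a bound
  with progression-hits (suc (suc k) * gcd a b) 0 (a ∸ b) (*-mono-≤ {1} {suc (suc k)} (s≤s z≤n) (gcd-positive a 0<b)) z≤n
... | s , above , below with bezout-multiple a b (<-≤-trans 0<b b≤a) 0<b s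
... | c , e , offset = c , e , offset-window-sub offset left right
  where
  open ≤-Reasoning
  g = gcd a b
  scaled : g * s * suc (suc k) ≡ s * (suc (suc k) * g) + 0
  scaled = rearrange g s (suc (suc k))
    where
    rearrange : ∀ g s n → g * s * n ≡ s * (n * g) + 0
    rearrange g s n = solve (g ∷ s ∷ n ∷ [])
  left : a ≤ g * s * suc (suc k) + b
  left = begin
    a                              ≡⟨ m∸n+n≡m b≤a ⟨
    (a ∸ b) + b                    ≤⟨ +-monoˡ-≤ b above ⟩
    s * (suc (suc k) * g) + 0 + b  ≡⟨ cong (_+ b) scaled ⟨
    g * s * suc (suc k) + b        ∎
  right : g * s * suc (suc k) + b * suc k ≤ a * suc k
  right = begin
    g * s * suc (suc k) + b * suc k               ≡⟨ cong (_+ b * suc k) scaled ⟩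
    s * (suc (suc k) * g) + 0 + b * suc k         ≤⟨ +-monoˡ-≤ (b * suc k) below ⟩
    (a ∸ b) + suc (suc k) * g + b * suc k         ≤⟨ +-monoˡ-≤ (b * suc k) (+-monoʳ-≤ (a ∸ b)
                                                       (subst (λ n → n * g ≤ k * (a ∸ b)) (+-comm (suc k) 1) bound)) ⟩
    suc k * (a ∸ b) + b * suc k                   ≡⟨ cong (_+ b * suc k) (*-comm (suc k) (a ∸ b)) ⟩
    (a ∸ b) * suc k + b * suc k                   ≡⟨ *-distribʳ-+ (suc k) (a ∸ b) b ⟨
    ((a ∸ b) + b) * suc k                         ≡⟨ cong (_* suc k) (m∸n+n≡m b≤a) ⟩
    a * suc k                                     ∎

window-at : ∀ {k} a b T c → a * (c * suc k + 1) ≤ b * T → b * T ≤ a * (c * suc k + k) →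
            InWindow k (T * b) (suc k * a) c
window-at {k} a b T c lower upper = in-window lower′ upper′
  where
  open ≤-Reasoning
  lower′ : suc k * a * (c * suc k + 1) ≤ suc k * (T * b)
  lower′ = begin
    suc k * a * (c * suc k + 1)   ≡⟨ *-assoc (suc k) a _ ⟩
    suc k * (a * (c * suc k + 1)) ≤⟨ *-monoʳ-≤ (suc k) lower ⟩
    suc k * (b * T)               ≡⟨ cong (suc k *_) (*-comm b T) ⟩
    suc k * (T * b)               ∎
  upper′ : suc k * (T * b) ≤ suc k * a * (c * suc k + k)
  upper′ = begin
    suc k * (T * b)               ≡⟨ cong (suc k *_) (*-comm T b) ⟩
    suc k * (b * T)               ≤⟨ *-monoʳ-≤ (suc k) upper ⟩
    suc k * (a * (c * suc k + k)) ≡⟨ *-assoc (suc k) a _ ⟨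
    suc k * a * (c * suc k + k)   ∎

left-end-in-window : ∀ {k} a c → 1 ≤ k → InWindow k ((c * suc k + 1) * a) (suc k * a) c
left-end-in-window {k} a c 1≤k = window-at a a (c * suc k + 1) c ≤-refl (*-monoʳ-≤ a (+-monoʳ-≤ (c * suc k) 1≤k))

-- The common time is the first left end of an a-window after the left end of
-- the b-window, or, if that one is too far to the right, the left end of the
-- b-window itself (which then lies in the preceding a-window).
window-meet : ∀ {k a b} → 0 < a → 0 < b → 2 * b ≤ (k ∸ 1) * a → ∀ c →
  Σ ℕ λ T → Σ ℕ λ D → 0 < D × (Σ ℕ λ e → InWindow k (T * a) D e) × InWindow k (T * b) D c
window-meet {zero} {a} {suc b} _ _ ()
window-meet {suc k} {a} {b} 0<a 0<b ratio c
  with left-end-hits (suc k) b (a * (c * suc (suc k) + 1)) 0<b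
... | e , after , near with b * (e * suc (suc k) + 1) ≤? a * (c * suc (suc k) + 1) + 2 * b
...   | yes close = e * suc (suc k) + 1 , suc (suc k) * a , *-mono-≤ {1} {suc (suc k)} (s≤s z≤n) 0<a ,
                    (e , left-end-in-window a e (s≤s z≤n)) , window-at a b (e * suc (suc k) + 1) c after (begin
  b * (e * suc (suc k) + 1)            ≤⟨ close ⟩
  a * (c * suc (suc k) + 1) + 2 * b    ≤⟨ +-monoʳ-≤ (a * (c * suc (suc k) + 1)) ratio ⟩
  a * (c * suc (suc k) + 1) + k * a    ≡⟨ solve (a ∷ c ∷ k ∷ []) ⟩
  a * (c * suc (suc k) + suc k)        ∎)
  where open ≤-Reasoning
...   | no far with e
...     | zero = ⊥-elim (far (begin
  b * 1                                ≡⟨ *-identityʳ b ⟩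
  b                                    ≤⟨ m≤m+n b (1 * b) ⟩
  2 * b                                ≤⟨ m≤n+m (2 * b) (a * (c * suc (suc k) + 1)) ⟩
  a * (c * suc (suc k) + 1) + 2 * b    ∎))
  where open ≤-Reasoning
...     | suc e' = c * suc (suc k) + 1 , suc (suc k) * b , *-mono-≤ {1} {suc (suc k)} (s≤s z≤n) 0<b ,
                   (e' , window-at b a (c * suc (suc k) + 1) e' lower upper) , left-end-in-window b c (s≤s z≤n)
  where
  A = a * (c * suc (suc k) + 1)
  next-left : b * (suc e' * suc (suc k) + 1) ≡ b * (e' * suc (suc k) + 1) + b * suc (suc k)
  next-left = solve (b ∷ e' ∷ k ∷ [])
  next-left-from-right : b * (suc e' * suc (suc k) + 1) ≡ b * (e' * suc (suc k) + suc k) + 2 * b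
  next-left-from-right = solve (b ∷ e' ∷ k ∷ [])
  lower : b * (e' * suc (suc k) + 1) ≤ a * (c * suc (suc k) + 1)
  lower = +-cancelʳ-≤ (b * suc (suc k)) _ _ (subst (_≤ A + b * suc (suc k)) next-left near)
  upper : a * (c * suc (suc k) + 1) ≤ b * (e' * suc (suc k) + suc k)
  upper = ≤-trans (n≤1+n A) (+-cancelʳ-≤ (2 * b) (suc A) _ (subst (suc A + 2 * b ≤_) next-left-from-right (≰⇒> far)))

Controls : ℕ → (ℕ → ℕ) → ℕ → ℕ → ℕ → Set
Controls k f j m c =
  ∀ T D → InWindow k (T * f j) D c → ∀ i → j ≤ i → i ≤ m → Σ ℕ λ c' → InWindow k (T * f i) D c'

controls-self : ∀ {k f m} c → Controls k f m m c
controls-self {k} {f} {m} c T D w i m≤i i≤m =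
  subst (λ i → Σ ℕ λ c' → InWindow k (T * f i) D c') (≤-antisym m≤i i≤m) (c , w)

controls-extend : ∀ {k f j m c c'} → 0 < f j → WindowSub k (f j) c (f (suc j)) c' →
                  Controls k f (suc j) m c' → Controls k f j m c
controls-extend {c = c} 0<f sub rest T D w i j≤i i≤m with m≤n⇒m<n∨m≡n j≤i
... | inj₁ j<i = rest T D (window-sub T 0<f sub w) i j<i i≤m
... | inj₂ refl = c , w

Refining : ℕ → (ℕ → ℕ) → ℕ → ℕ → Set
Refining k f j m = ∀ i → j ≤ i → i < m → 0 < f i × (∀ c' → Σ ℕ λ c → WindowSub k (f i) c (f (suc i)) c')

controls-step : ∀ {k f j m} → 0 < f j × (∀ c' → Σ ℕ λ c → WindowSub k (f j) c (f (suc j)) c') →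
                Σ ℕ (Controls k f (suc j) m) → Σ ℕ (Controls k f j m)
controls-step (0<f , refine) (c' , controls) with refine c'
... | c , sub = c , controls-extend 0<f sub controls

controls-descend : ∀ {k f m} d j → Refining k f j (j + d) → Σ ℕ (Controls k f (j + d) m) → Σ ℕ (Controls k f j m)
controls-descend {k} {f} {m} zero j _ top = subst (λ i → Σ ℕ (Controls k f i m)) (+-identityʳ j) top
controls-descend {k} {f} {m} (suc d) j refining top =
  controls-step (refining j ≤-refl (subst (j <_) (sym (+-suc j d)) (s≤s (m≤m+n j d))))
                (controls-descend d (suc j) refining-above (subst (λ i → Σ ℕ (Controls k f i m)) (+-suc j d) top))
  where
  refining-above : Refining k f (suc j) (suc j + d)
  refining-above i j<i i<m = refining i (<⇒≤ j<i) (subst (i <_) (sym (+-suc j d)) i<m)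

last-pair : ∀ {k f} m → 0 < f (suc m) → f (suc m) ≤ f m →
            (k + 1) * gcd (f m) (f (suc m)) ≤ (k ∸ 1) * (f m ∸ f (suc m)) → Σ ℕ (Controls k f m (suc m))
last-pair m 0<b b≤a bound with window-gcd 0<b b≤a bound
... | c , e , sub = c , controls-extend (<-≤-trans 0<b b≤a) sub (controls-self e)

GoodTime : ℕ → (ℕ → ℕ) → Set
GoodTime k f = Σ ℕ λ T → Σ ℕ λ D → 0 < D × ∀ i → 1 ≤ i → i ≤ k → Σ ℕ λ c → InWindow k (T * f i) D c

good-time-at-left-end : ∀ {k f c} → 1 ≤ k → 0 < f 1 → Controls k f 1 k c → GoodTime k f
good-time-at-left-end {k} {f} {c} 1≤k 0<f controls =
  c * suc k + 1 , suc k * f 1 , *-mono-≤ {1} {suc k} (s≤s z≤n) 0<f , controls (c * suc k + 1) (suc k * f 1) (left-end-in-window (f 1) c 1≤k)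

good-time-at-meeting : ∀ {k f c} → 0 < f 1 → 0 < f 2 → 2 * f 2 ≤ (k ∸ 1) * f 1 → Controls k f 2 k c → GoodTime k f
good-time-at-meeting {k} {f} {c} 0<f₁ 0<f₂ ratio controls with window-meet 0<f₁ 0<f₂ ratio c
... | T , D , 0<D , (e , first) , second = T , D , 0<D , windows
  where
  windows : ∀ i → 1 ≤ i → i ≤ k → Σ ℕ λ c' → InWindow k (T * f i) D c'
  windows i 1≤i i≤k with m≤n⇒m<n∨m≡n 1≤i
  ... | inj₁ 1<i = controls T D second i 1<i i≤k
  ... | inj₂ refl = e , first

lookup-nth : ∀ {k} (n : Vec ℕ k) (j : Fin k) → lookup n j ≡ nth n (suc (toℕ j))
lookup-nth (x Vec.∷ xs) Fin.zero = refl
lookup-nth (x Vec.∷ xs) (Fin.suc j) = lookup-nth xs j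

lonely-at-good-time : ∀ {k} (n : Vec ℕ k) → GoodTime k (nth n) → LonelyRunnerInstance n
lonely-at-good-time n (T , zero , () , _)
lonely-at-good-time {k} n (T , suc D' , _ , windows) = + T / suc D' , far
  where
  far : ∀ j → FarFromIntegers k ((+ T / suc D') ℚ.* (+ lookup n j / 1))
  far j with windows (suc (toℕ j)) (s≤s z≤n) (toℕ<n j)
  ... | c , w rewrite lookup-nth n j = far-from-integers k (+ T) (+ nth n (suc (toℕ j))) D' λ m →
    subst (λ p → suc D' ≤ ℤ.∣ p ℤ.- m ℤ.* + suc D' ∣ * suc k) (ℤP.pos-* T _) (window-far w m)

theorem8 : (k : ℕ) → 2 ≤ k → (n : Vec ℕ k)
    → (∀ j → 1 ≤ j → j ≤ k → 0 < nth n j)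
    → (∀ j → 1 ≤ j → j < k → nth n (j + 1) ≤ nth n j)
    → (∀ j → 2 ≤ j → j ≤ k ∸ 2 → (2 * k) * nth n (j + 1) ≤ (k ∸ 1) * nth n j)
    → (k + 1) * gcd (nth n (k ∸ 1)) (nth n k) ≤ (k ∸ 1) * (nth n (k ∸ 1) ∸ nth n k)
    → LonelyRunnerInstance n
theorem8 zero () n pos dec rat gh
theorem8 (suc zero) (s≤s ()) n pos dec rat gh
theorem8 (suc (suc zero)) _ n pos dec rat gh =
  lonely-at-good-time n (good-time-at-left-end (s≤s z≤n) (pos 1 (s≤s z≤n) (s≤s z≤n))
    (proj₂ (last-pair 1 (pos 2 (s≤s z≤n) ≤-refl) (dec 1 ≤-refl ≤-refl) gh)))
theorem8 k@(suc (suc (suc m))) _ n pos dec rat gh =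
  lonely-at-good-time n (good-time-at-meeting (pos 1 (s≤s z≤n) (s≤s z≤n)) (pos 2 (s≤s z≤n) (s≤s (s≤s z≤n)))
    (*-mono-≤ {2} {suc (suc m)} (s≤s (s≤s z≤n)) (dec 1 ≤-refl (s≤s (s≤s z≤n))))
    (proj₂ (controls-descend m 2 refining
      (last-pair (suc (suc m)) (pos k (s≤s z≤n) ≤-refl) (decreasing (suc (suc m)) (s≤s z≤n) ≤-refl) gh))))
  where
  decreasing : ∀ j → 1 ≤ j → j < k → nth n (suc j) ≤ nth n j
  decreasing j 1≤j j<k = subst (λ i → nth n i ≤ nth n j) (+-comm j 1) (dec j 1≤j j<k)
  refining : Refining k (nth n) 2 (2 + m)
  refining i 2≤i i<k-1 = pos i (≤-trans (s≤s z≤n) 2≤i) (≤-trans (<⇒≤ i<k-1) (n≤1+n _)) ,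
    window-step (s≤s z≤n) (pos (suc i) (s≤s z≤n) (s≤s (<⇒≤ i<k-1)))
      (subst (λ j → 2 * k * nth n j ≤ (k ∸ 1) * nth n i) (+-comm i 1) (rat i 2≤i (s≤s⁻¹ i<k-1)))
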